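{- Let $n,k,p,i$ be positive integers with $i\ge 3$ and $n>(i-2)k$. Then $$\binom{n-i}{k-2}-\binom{n-p-i}{k-2}\ \ge\ \frac{n-(i-2)k+2i-6}{n-2}\left(\binom{n-2}{k-2}-\binom{n-p-2}{k-2}\right).$$
   Context: Binomial coefficients $\binom{m}{j}$ (with $m,j$ integers) are taken to be $0$ when $j<0$ or $m<j$. -}

module Defs where

open import Data.Nat using (ℕ)
open import Data.Nat.Combinatorics using (_C_)
open import Data.Integer using (ℤ; +_; -[1+_])

-- Binomial coefficient with integer arguments: binom m j = 0 if j < 0 or m < j
-- (for m ≥ 0, ℕ's _C_ already returns 0 when j > m; for m < 0 and j ≥ 0, m < j holds).
binom : ℤ → ℤ → ℤ
binom (+ m)    (+ j)    = + (m C j)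
binom (+ m)    -[1+ _ ] = + 0
binom -[1+ _ ] _        = + 0

{-# OPTIONS --safe #-}
module Submission where

-- Put m = k - 2, s = i - 2, a = n - 2 and ∇(x) = C(x,m) - C(x-p,m); the claim is
-- (a - s m) ∇(a) ≤ a ∇(a - s). By the absorption identity x C(x-1,m) = (x-m) C(x,m)
-- the ratio C(x-1,m)/C(x,m) = 1 - m/x increases with x, whence ∇(b-1) ≥ (1 - m/b) ∇(b)
-- for b ≥ m. Induction on s then only needs the Bernoulli-type inequality
-- (1 - s m/a) (1 - m/(a-s)) ≥ 1 - (s+1) m/a.

open import Defs
open import Data.Nat using (ℕ; zero; suc; s≤s; z≤n)
import Data.Nat as ℕ
import Data.Nat.Properties as ℕP
open import Data.Nat.Combinatorics using (_C_; nCk+nC[k+1]≡[n+1]C[k+1]; nC1≡n)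
open import Relation.Binary.PropositionalEquality
open import Relation.Nullary using (yes; no)

module _ where
  open import Data.Nat.Tactic.RingSolver using (solve-∀)
  open Data.Nat using (_+_; _*_; _≤_)
  open ≡-Reasoning

  pascal : ∀ n k → suc n C suc k ≡ n C k + n C suc k
  pascal n k = sym (nCk+nC[k+1]≡[n+1]C[k+1] n k)

  [k+1]*[n+1]C[k+1]≡[n+1]*nCk : ∀ n k → suc k * (suc n C suc k) ≡ suc n * (n C k)
  [k+1]*[n+1]C[k+1]≡[n+1]*nCk zero    zero    = refl
  [k+1]*[n+1]C[k+1]≡[n+1]*nCk zero    (suc k) = ℕP.*-zeroʳ (suc (suc k))
  [k+1]*[n+1]C[k+1]≡[n+1]*nCk (suc n) zero    =
    trans (ℕP.+-identityʳ _) (trans (nC1≡n (suc (suc n))) (sym (ℕP.*-identityʳ _)))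
  [k+1]*[n+1]C[k+1]≡[n+1]*nCk (suc n) (suc k) = begin
      suc (suc k) * (suc (suc n) C suc (suc k))
    ≡⟨ cong (suc (suc k) *_) (pascal (suc n) (suc k)) ⟩
      suc (suc k) * (suc n C suc k + suc n C suc (suc k))
    ≡⟨ split k (suc n C suc k) (suc n C suc (suc k)) ⟩
      suc n C suc k + suc k * (suc n C suc k) + suc (suc k) * (suc n C suc (suc k))
    ≡⟨ cong₂ (λ u v → suc n C suc k + u + v)
         ([k+1]*[n+1]C[k+1]≡[n+1]*nCk n k) ([k+1]*[n+1]C[k+1]≡[n+1]*nCk n (suc k)) ⟩
      suc n C suc k + suc n * (n C k) + suc n * (n C suc k)
    ≡⟨ cong (λ u → u + suc n * (n C k) + suc n * (n C suc k)) (pascal n k) ⟩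
      (n C k + n C suc k) + suc n * (n C k) + suc n * (n C suc k)
    ≡⟨ merge (suc n) (n C k) (n C suc k) ⟩
      suc (suc n) * (n C k + n C suc k)
    ≡⟨ cong (suc (suc n) *_) (pascal n k) ⟨
      suc (suc n) * (suc n C suc k)
    ∎
    where
    split : ∀ j x y → (2 + j) * (x + y) ≡ x + (1 + j) * x + (2 + j) * y
    split = solve-∀
    merge : ∀ z x y → (x + y) + z * x + z * y ≡ (1 + z) * (x + y)
    merge = solve-∀

  [n+1]*nCk+k*[n+1]Ck≡[n+1]*[n+1]Ck : ∀ n k → suc n * (n C k) + k * (suc n C k) ≡ suc n * (suc n C k)
  [n+1]*nCk+k*[n+1]Ck≡[n+1]*[n+1]Ck n zero    = ℕP.+-identityʳ _
  [n+1]*nCk+k*[n+1]Ck≡[n+1]*[n+1]Ck n (suc k) = begin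
      suc n * (n C suc k) + suc k * (suc n C suc k)
    ≡⟨ cong (suc n * (n C suc k) +_) ([k+1]*[n+1]C[k+1]≡[n+1]*nCk n k) ⟩
      suc n * (n C suc k) + suc n * (n C k)
    ≡⟨ ℕP.+-comm (suc n * (n C suc k)) _ ⟩
      suc n * (n C k) + suc n * (n C suc k)
    ≡⟨ ℕP.*-distribˡ-+ (suc n) (n C k) _ ⟨
      suc n * (n C k + n C suc k)
    ≡⟨ cong (suc n *_) (pascal n k) ⟨
      suc n * (suc n C suc k)
    ∎

  nCk≤[n+1]Ck : ∀ n k → n C k ≤ suc n C k
  nCk≤[n+1]Ck n zero    = ℕP.≤-refl
  nCk≤[n+1]Ck n (suc k) = subst (n C suc k ≤_) (sym (pascal n k)) (ℕP.m≤n+m (n C suc k) (n C k))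

open import Data.Integer
  using (ℤ; +_; -[1+_]; 0ℤ; 1ℤ; _+_; _-_; _*_; _≤_; _<_; +≤+; nonNegative; positive)
open import Data.Integer.Properties
open import Data.Integer.Tactic.RingSolver using (solve-∀)
open import Algebra.Properties.CommutativeSemigroup *-commutativeSemigroup using (x∙yz≈y∙xz)

≤-via-difference : ∀ {x y u v : ℤ} → y - x ≡ v - u → u ≤ v → x ≤ y
≤-via-difference eq u≤v = 0≤i-j⇒j≤i (subst (0ℤ ≤_) (sym eq) (i≤j⇒0≤j-i u≤v))

*-monoˡ-≤-0≤ : ∀ {x y z : ℤ} → 0ℤ ≤ x → y ≤ z → x * y ≤ x * z
*-monoˡ-≤-0≤ {x} 0≤x = *-monoˡ-≤-nonNeg x {{nonNegative 0≤x}}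

0≤i⇒0≤j⇒0≤i*j : ∀ {x y : ℤ} → 0ℤ ≤ x → 0ℤ ≤ y → 0ℤ ≤ x * y
0≤i⇒0≤j⇒0≤i*j {x} {y} 0≤x 0≤y = subst (_≤ x * y) (*-zeroʳ x) (*-monoˡ-≤-0≤ 0≤x 0≤y)

*-monoʳ-≤-0≤ : ∀ {x y z : ℤ} → 0ℤ ≤ x → y ≤ z → y * x ≤ z * x
*-monoʳ-≤-0≤ {x} 0≤x = *-monoʳ-≤-nonNeg x {{nonNegative 0≤x}}

*-cancelˡ-≤-0< : ∀ {x y z : ℤ} → 0ℤ < x → x * y ≤ x * z → y ≤ z
*-cancelˡ-≤-0< {x} {y} {z} 0<x = *-cancelˡ-≤-pos y z x {{positive 0<x}}

binom-nonneg : ∀ m x → 0ℤ ≤ binom x (+ m)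
binom-nonneg m (+ _)      = +≤+ z≤n
binom-nonneg m -[1+ _ ]   = +≤+ z≤n

binom-neg : ∀ x j → binom x -[1+ j ] ≡ 0ℤ
binom-neg (+ _)    j = refl
binom-neg -[1+ _ ] j = refl

binom-pred-of-≤0 : ∀ m x → x ≤ 0ℤ → binom (x - 1ℤ) (+ m) ≡ 0ℤ
binom-pred-of-≤0 m (+ zero)  _ = refl
binom-pred-of-≤0 m -[1+ _ ]  _ = refl
binom-pred-of-≤0 m (+ suc _) (+≤+ ())

binom-pred-≤ : ∀ m x → binom (x - 1ℤ) (+ m) ≤ binom x (+ m)
binom-pred-≤ m (+ zero)   = +≤+ z≤n
binom-pred-≤ m (+ suc n)  = +≤+ (nCk≤[n+1]Ck n m)
binom-pred-≤ m -[1+ _ ]   = +≤+ z≤n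

binom-sub-≤ : ∀ m p x → binom (x - + p) (+ m) ≤ binom x (+ m)
binom-sub-≤ m zero    x = ≤-reflexive (cong (λ y → binom y (+ m)) (+-identityʳ x))
binom-sub-≤ m (suc p) x = ≤-trans (≤-reflexive (cong (λ y → binom y (+ m)) (shift x (+ p))))
                         (≤-trans (binom-pred-≤ m (x - + p)) (binom-sub-≤ m p x))
  where
  shift : ∀ x q → x - (1ℤ + q) ≡ (x - q) - 1ℤ
  shift = solve-∀

binom-absorption : ∀ m x → x * binom (x - 1ℤ) (+ m) ≡ (x - + m) * binom x (+ m)
binom-absorption zero    (+ zero) = refl
binom-absorption (suc m) (+ zero) = sym (*-zeroʳ (0ℤ - + suc m))
binom-absorption m -[1+ n ]  = trans (*-zeroʳ -[1+ n ]) (sym (*-zeroʳ (-[1+ n ] - + m)))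
binom-absorption m (+ suc n) = begin
    N * B′
  ≡⟨ isolate (N * B′) (M * B) ⟩
    (N * B′ + M * B) - M * B
  ≡⟨ cong (_- M * B) lifted ⟩
    N * B - M * B
  ≡⟨ factor N M B ⟩
    (N - M) * B
  ∎
  where
  open ≡-Reasoning
  N = + suc n
  M = + m
  B = + (suc n C m)
  B′ = + (n C m)
  isolate : ∀ x y → x ≡ (x + y) - y
  isolate = solve-∀
  factor : ∀ x y z → x * z - y * z ≡ (x - y) * z
  factor = solve-∀
  lifted : N * B′ + M * B ≡ N * B
  lifted = begin
      N * B′ + M * B
    ≡⟨ cong₂ _+_ (pos-* (suc n) (n C m)) (pos-* m (suc n C m)) ⟨
      + (suc n ℕ.* (n C m)) + + (m ℕ.* (suc n C m))
    ≡⟨ pos-+ (suc n ℕ.* (n C m)) _ ⟨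
      + (suc n ℕ.* (n C m) ℕ.+ m ℕ.* (suc n C m))
    ≡⟨ cong +_ ([n+1]*nCk+k*[n+1]Ck≡[n+1]*[n+1]Ck n m) ⟩
      + (suc n ℕ.* (suc n C m))
    ≡⟨ pos-* (suc n) (suc n C m) ⟩
      N * B
    ∎

binom-pred-ratio-≤ : ∀ m {b c} → c ≤ b → + m ≤ b →
                     b * binom (c - 1ℤ) (+ m) ≤ (b - + m) * binom c (+ m)
binom-pred-ratio-≤ m {b} {c} c≤b m≤b with c ≤? 0ℤ
... | yes c≤0 = begin
    b * binom (c - 1ℤ) (+ m) ≡⟨ cong (b *_) (binom-pred-of-≤0 m c c≤0) ⟩
    b * 0ℤ                   ≡⟨ *-zeroʳ b ⟩
    0ℤ                       ≤⟨ 0≤i⇒0≤j⇒0≤i*j (i≤j⇒0≤j-i m≤b) (binom-nonneg m c) ⟩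
    (b - + m) * binom c (+ m) ∎
  where open ≤-Reasoning
... | no c≰0 = *-cancelˡ-≤-0< (≰⇒> c≰0) (begin
    c * (b * binom (c - 1ℤ) (+ m))   ≡⟨ x∙yz≈y∙xz c b _ ⟩
    b * (c * binom (c - 1ℤ) (+ m))   ≡⟨ cong (b *_) (binom-absorption m c) ⟩
    b * ((c - + m) * binom c (+ m))  ≡⟨ *-assoc b _ _ ⟨
    b * (c - + m) * binom c (+ m)    ≤⟨ *-monoʳ-≤-0≤ (binom-nonneg m c) ratio ⟩
    c * (b - + m) * binom c (+ m)    ≡⟨ *-assoc c _ _ ⟩
    c * ((b - + m) * binom c (+ m))  ∎)
  where
  open ≤-Reasoning
  gap : ∀ b c m → c * (b - m) - b * (c - m) ≡ m * b - m * c
  gap = solve-∀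
  ratio : b * (c - + m) ≤ c * (b - + m)
  ratio = ≤-via-difference (gap b c (+ m)) (*-monoˡ-≤-nonNeg (+ m) c≤b)

∇binom : ℕ → ℕ → ℤ → ℤ
∇binom m p x = binom x (+ m) - binom (x - + p) (+ m)

∇binom-nonneg : ∀ m p x → 0ℤ ≤ ∇binom m p x
∇binom-nonneg m p x = i≤j⇒0≤j-i (binom-sub-≤ m p x)

∇binom-pred-ratio-≤ : ∀ m p {b} → + m ≤ b → (b - + m) * ∇binom m p b ≤ b * ∇binom m p (b - 1ℤ)
∇binom-pred-ratio-≤ m p {b} m≤b = begin
    (b - + m) * (binom b (+ m) - binom (b - + p) (+ m))
  ≡⟨ *-distribˡ-minus (b - + m) _ _ ⟩
    (b - + m) * binom b (+ m) - (b - + m) * binom (b - + p) (+ m)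
  ≤⟨ +-monoʳ-≤ ((b - + m) * binom b (+ m)) (neg-mono-≤ (binom-pred-ratio-≤ m (i-j≤i b (+ p)) m≤b)) ⟩
    (b - + m) * binom b (+ m) - b * binom (b - + p - 1ℤ) (+ m)
  ≡⟨ cong₂ _-_ (binom-absorption m b) (cong (λ x → b * binom x (+ m)) (sub-comm b (+ p) 1ℤ)) ⟨
    b * binom (b - 1ℤ) (+ m) - b * binom (b - 1ℤ - + p) (+ m)
  ≡⟨ *-distribˡ-minus b _ _ ⟨
    b * (binom (b - 1ℤ) (+ m) - binom (b - 1ℤ - + p) (+ m))
  ∎
  where
  open ≤-Reasoning
  *-distribˡ-minus : ∀ x y z → x * (y - z) ≡ x * y - x * z
  *-distribˡ-minus = solve-∀
  sub-comm : ∀ x y z → x - z - y ≡ x - y - z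
  sub-comm = solve-∀

[a-s]*[a-[1+s]m]≤[a-s-m]*[a-sm] : ∀ a s m →
  (a - + s) * (a - + suc s * + m) ≤ (a - + s - + m) * (a - + s * + m)
[a-s]*[a-[1+s]m]≤[a-s-m]*[a-sm] a s m =
  ≤-via-difference (excess a (+ s) (+ m)) (0≤i⇒0≤j⇒0≤i*j {+ s} (+≤+ z≤n) (0≤m*[m-1] m))
  where
  excess : ∀ a s m → (a - s - m) * (a - s * m) - (a - s) * (a - (1ℤ + s) * m) ≡ s * (m * (m - 1ℤ)) - 0ℤ
  excess = solve-∀
  0≤m*[m-1] : ∀ m → 0ℤ ≤ + m * (+ m - 1ℤ)
  0≤m*[m-1] zero    = +≤+ z≤n
  0≤m*[m-1] (suc m) = 0≤i⇒0≤j⇒0≤i*j {+ suc m} {+ m} (+≤+ z≤n) (+≤+ z≤n)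

∇binom-shift-ratio-≤ : ∀ m p s {a} → + s + + m ≤ a + 1ℤ → + s ≤ a →
                       (a - + s * + m) * ∇binom m p a ≤ a * ∇binom m p (a - + s)
∇binom-shift-ratio-≤ m p zero    {a} _ _ =
  ≤-reflexive (cong₂ (λ x y → x * ∇binom m p y) (+-identityʳ a) (sym (+-identityʳ a)))
∇binom-shift-ratio-≤ m p (suc s) {a} s+m≤a+1 s<a = *-cancelˡ-≤-0< 0<b (begin
    b * ((a - + suc s * + m) * ∇binom m p a)
  ≡⟨ *-assoc b _ _ ⟨
    b * (a - + suc s * + m) * ∇binom m p a
  ≤⟨ *-monoʳ-≤-0≤ (∇binom-nonneg m p a) ([a-s]*[a-[1+s]m]≤[a-s-m]*[a-sm] a s m) ⟩
    (b - + m) * (a - + s * + m) * ∇binom m p a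
  ≡⟨ *-assoc (b - + m) _ _ ⟩
    (b - + m) * ((a - + s * + m) * ∇binom m p a)
  ≤⟨ *-monoˡ-≤-0≤ (i≤j⇒0≤j-i m≤b) (∇binom-shift-ratio-≤ m p s s+m≤a+1′ s≤a) ⟩
    (b - + m) * (a * ∇binom m p b)
  ≡⟨ x∙yz≈y∙xz (b - + m) a _ ⟩
    a * ((b - + m) * ∇binom m p b)
  ≤⟨ *-monoˡ-≤-0≤ 0≤a (∇binom-pred-ratio-≤ m p m≤b) ⟩
    a * (b * ∇binom m p (b - 1ℤ))
  ≡⟨ x∙yz≈y∙xz a b _ ⟩
    b * (a * ∇binom m p (b - 1ℤ))
  ≡⟨ cong (λ x → b * (a * ∇binom m p x)) (sub-sub a (+ s)) ⟩
    b * (a * ∇binom m p (a - + suc s))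
  ∎)
  where
  open ≤-Reasoning
  b = a - + s
  s+m≤a+1′ : + s + + m ≤ a + 1ℤ
  s+m≤a+1′ = ≤-trans (+≤+ (ℕP.n≤1+n (s ℕ.+ m))) s+m≤a+1
  s≤a : + s ≤ a
  s≤a = ≤-trans (+≤+ (ℕP.n≤1+n s)) s<a
  0≤a : 0ℤ ≤ a
  0≤a = ≤-trans (+≤+ z≤n) s<a
  sub-sub : ∀ a s → a - s - 1ℤ ≡ a - (1ℤ + s)
  sub-sub = solve-∀
  0<b : 0ℤ < b
  0<b = suc[i]≤j⇒i<j (≤-via-difference (sub-sub a (+ s)) s<a)
  margin : ∀ a s m → a - s - m ≡ (a + 1ℤ) - (1ℤ + s + m)
  margin = solve-∀
  m≤b : + m ≤ b
  m≤b = ≤-via-difference (margin a (+ s) (+ m)) s+m≤a+1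

s+m<s*[2+m] : ∀ {s} m → 1 ℕ.≤ s → s ℕ.+ m ℕ.< s ℕ.* (2 ℕ.+ m)
s+m<s*[2+m] {suc s} m _ =
  s≤s (s≤s (ℕP.≤-trans (ℕP.≤-reflexive (ℕP.+-comm s m)) (ℕP.+-monoʳ-≤ m (ℕP.m≤m*n s (2 ℕ.+ m)))))

proposition1p14 : (n k p i : ℕ) → n ℕ.> 0 → k ℕ.> 0 → p ℕ.> 0 → i ℕ.≥ 3 → n ℕ.> (i ℕ.∸ 2) ℕ.* k →
    (+ n - (+ i - + 2) * + k + + 2 * + i - + 6)
      * (binom (+ n - + 2) (+ k - + 2) - binom (+ n - + p - + 2) (+ k - + 2))
      ≤ (+ n - + 2) * (binom (+ n - + i) (+ k - + 2) - binom (+ n - + p - + i) (+ k - + 2))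
proposition1p14 n zero p i _ () _ _ _
proposition1p14 n (suc zero) p i _ _ _ _ _ =
  ≤-reflexive (trans (vanish (+ n - (+ i - + 2) * + 1 + + 2 * + i - + 6) (+ n - + 2) (+ n - + p - + 2))
                      (sym (vanish (+ n - + 2) (+ n - + i) (+ n - + p - + i))))
  where
  vanish : ∀ c x y → c * (binom x -[1+ 0 ] - binom y -[1+ 0 ]) ≡ 0ℤ
  vanish c x y rewrite binom-neg x 0 | binom-neg y 0 = *-zeroʳ c
proposition1p14 n (suc (suc m)) p zero             _ _ _ ()               _
proposition1p14 n (suc (suc m)) p (suc zero)       _ _ _ (s≤s ())         _
proposition1p14 n (suc (suc m)) p (suc (suc zero)) _ _ _ (s≤s (s≤s ()))   _
proposition1p14 n (suc (suc m)) p (suc (suc s)) _ _ _ (s≤s (s≤s 1≤s)) n>sk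
  with n | ℕP.≤-<-trans (s+m<s*[2+m] m 1≤s) n>sk
... | suc (suc a) | s≤s (s≤s s+m≤a) =
  subst₂ _≤_
    (cong₂ _*_ (coefficient (+ a) (+ s) (+ m)) (cong (λ x → binom (+ a) (+ m) - binom x (+ m)) (shift₁ (+ a) (+ p))))
    (cong (+ a *_) (cong₂ (λ x y → binom x (+ m) - binom y (+ m)) (shift₂ (+ a) (+ s)) (shift₃ (+ a) (+ s) (+ p))))
    (∇binom-shift-ratio-≤ m p s (+≤+ (ℕP.m≤n⇒m≤n+o 1 s+m≤a)) (+≤+ (ℕP.≤-trans (ℕP.m≤m+n s m) s+m≤a)))
  where
  coefficient : ∀ a s m → a - s * m ≡ + 2 + a - (+ 2 + s - + 2) * (+ 2 + m) + + 2 * (+ 2 + s) - + 6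
  coefficient = solve-∀
  shift₁ : ∀ a p → a - p ≡ + 2 + a - p - + 2
  shift₁ = solve-∀
  shift₂ : ∀ a s → a - s ≡ + 2 + a - (+ 2 + s)
  shift₂ = solve-∀
  shift₃ : ∀ a s p → a - s - p ≡ + 2 + a - p - (+ 2 + s)
  shift₃ = solve-∀
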